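{- Let $A=\{a_1,\dots,a_{3r}\}$ be a 3-partition instance and $(G,R_A)$ the ridesharing instance constructed from it as in the context. Then every solution for $(G,R_A)$ has every trip $i$ with $1\le i\le 3r$ as a driver, and has total travel distance of drivers at least $3r\cdot(r+1)$.
   Context: Ridesharing problem. A road network is an undirected graph $G$ with nonnegative edge lengths (travel time proportional to distance). An instance consists of $G$ and a set of trips, each trip $i$ having source $s_i$, destination $t_i$, capacity $n_i\ge0$ (seats for passengers), detour limit $d_i$, a set of preferred $s_i$–$t_i$ paths, stop limit $\delta_i$ (maximum number of pick-up stops at locations other than $s_i$), earliest departure time $\alpha_i$, latest arrival time $\beta_i$. Trip $i$ can serve $\sigma(i)\ni i$ if $i$'s vehicle can pick up each $j\in\sigma(i)\setminus\{i\}$ at $s_j$ (not before $\alpha_j$) and deliver each $j\in\sigma(i)$ to $t_j$ by $\beta_j$, with detour at most $d_i$ from its preferred path, at most $\delta_i$ pick-up stops, no re-taking of passengers ($|\sigma(i)|\le n_i+1$). A solution $(S,\sigma)$: $S$ a set of drivers, $\sigma(i)$ ($i\in S$) served by $i$, pairwise disjoint, covering all trips. Total travel distance = sum of travel distances of drivers. 3-partition instance: $3r$ positive integers, $r\ge 2$, $\sum a_i=rM$, $M/4<a_i<M/2$. Construction of $(G,R_A)$: $V(G)=\{D,u_1,\dots,u_{3r},v_1,\dots,v_r\}$, edges $\{u_i,v_1\}$ ($1\le i\le 3r$), $\{v_i,v_{i+1}\}$ ($1\le i\le r-1$), $\{v_r,D\}$, all of length 1. $R_A=\{1,\dots,3r+rM\}$;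 $\alpha<\beta$ are time constants allowing every trip to reach $D$ in time. For $1\le i\le 3r$: $s_i=u_i$, $t_i=D$, $n_i=a_i$, $d_i=0$, $\delta_i=1$, $\alpha_i=\alpha$, $\beta_i=\beta$, unique preferred path $u_i,v_1,\dots,v_r,D$. For $3r+1\le i\le 3r+rM$: $s_i=v_j$ with $j=\lceil (i-3r)/M\rceil$, $t_i=D$, $n_i=0$, $\delta_i=0$, $d_i=0$, $\alpha_i=\alpha$, $\beta_i=\beta$, unique preferred path $v_j,v_{j+1},\dots,v_r,D$. -}

module Defs where

open import Data.Nat using (ℕ; zero; suc; _+_; _*_; _≤_; _<_; _≤?_)
open import Data.Fin using (Fin; toℕ; splitAt; quotient)
import Data.Fin as F
open import Data.List using (List; []; _∷_; _++_; map; filter; length; lookup; deduplicate; allFin)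
open import Data.Nat.ListAction using (sum)
open import Data.List.Membership.Propositional using (_∈_)
open import Data.List.Relation.Unary.Unique.Propositional using (Unique)
open import Data.Product using (Σ; ∃; _×_; _,_; proj₁; proj₂)
open import Data.Sum using (_⊎_; inj₁; inj₂)
open import Data.Empty using (⊥)
open import Relation.Binary using (DecidableEquality)
open import Relation.Binary.PropositionalEquality using (_≡_; _≢_; refl; cong)
open import Relation.Nullary using (yes; no; ¬?)

-- An undirected graph with nonnegative (natural-number) edge lengths.
-- E x y ℓ : there is an edge {x,y} of length ℓ (stored in one orientation).
record Graph : Set₁ where
  field
    V    : Set
    _≟V_ : DecidableEquality V
    E    : V → V → ℕ → Set

module _ (G : Graph) where
  open Graph G

  Adj : V → V → ℕ → Set
  Adj x y ℓ = E x y ℓ ⊎ E y x ℓ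

  -- A (timed) walk: each step traverses an edge of length ℓ (taking time ℓ,
  -- travel time proportional to distance) and then possibly waits `wt`
  -- time units at the reached vertex.
  data Walk : V → V → Set where
    stay : ∀ {x} → Walk x x
    step : ∀ {x y z} (ℓ wt : ℕ) → Adj x y ℓ → Walk y z → Walk x z

  len : ∀ {x y} → Walk x y → ℕ
  len stay             = 0
  len (step ℓ _ _ w)   = ℓ + len w

  verts : ∀ {x y} → Walk x y → List V
  verts {x} stay           = x ∷ []
  verts {x} (step _ _ _ w) = x ∷ verts w

  -- visits a d w : the list of (vertex, arrival time, departure time) along w,
  -- when the start vertex is reached at time a and left at time d.
  visits : ∀ {x y} → ℕ → ℕ → Walk x y → List (V × ℕ × ℕ)
  visits {x} a d stay            = (x , a , d) ∷ []
  visits {x} a d (step ℓ wt _ w) = (x , a , d) ∷ visits (d + ℓ) (d + ℓ + wt) w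

  arrival : ∀ {x y} → ℕ → ℕ → Walk x y → ℕ
  arrival a d stay            = a
  arrival a d (step ℓ wt _ w) = arrival (d + ℓ) (d + ℓ + wt) w

  record Trip : Set₁ where
    field
      src dst   : V
      cap       : ℕ
      detour    : ℕ
      preferred : List V → Set   -- set of preferred src–dst paths (as vertex sequences)
      stopLim   : ℕ
      α β       : ℕ          -- earliest departure, latest arrival

  open Trip

  -- Along the visit list L, passenger t is picked up at its source (not before
  -- α t) and later dropped at its destination (by β t).
  PickDrop : List (V × ℕ × ℕ) → Trip → Set
  PickDrop L t =
    Σ (Fin (length L)) λ p → Σ (Fin (length L)) λ q →
      toℕ p ≤ toℕ q
      × proj₁ (lookup L p) ≡ src t × α t ≤ proj₂ (proj₂ (lookup L p))
      × proj₁ (lookup L q) ≡ dst t × proj₁ (proj₂ (lookup L q)) ≤ β t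

  module _ {m : ℕ} (T : Fin m → Trip) where

    stopCount : Fin m → List (Fin m) → ℕ
    stopCount i σ =
      length (deduplicate _≟V_ (filter (λ x → ¬? (x ≟V src (T i))) (map (λ j → src (T j)) σ)))

    record Serves (i : Fin m) (σ : List (Fin m)) (τ : ℕ)
                  (w : Walk (src (T i)) (dst (T i))) : Set where
      field
        self     : i ∈ σ
        capacity : length σ ≤ suc (cap (T i))
        depart   : α (T i) ≤ τ
        arrive   : arrival τ τ w ≤ β (T i)
        detourOK : Σ (Walk (src (T i)) (dst (T i))) λ P →
                     preferred (T i) (verts P) × len w ≤ len P + detour (T i)
        stops    : stopCount i σ ≤ stopLim (T i)
        carry    : ∀ j → j ∈ σ → j ≢ i → PickDrop (visits τ τ w) (T j)

    record Solution : Set₁ where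
      field
        S        : List (Fin m)
        S-uniq   : Unique S
        σ        : Fin m → List (Fin m)
        σ-uniq   : ∀ i → Unique (σ i)
        τ        : Fin m → ℕ
        route    : (i : Fin m) → Walk (src (T i)) (dst (T i))
        serves   : ∀ i → i ∈ S → Serves i (σ i) (τ i) (route i)
        disjoint : ∀ i k → i ∈ S → k ∈ S → i ≢ k → ∀ j → j ∈ σ i → j ∈ σ k → ⊥
        cover    : ∀ j → ∃ λ i → i ∈ S × j ∈ σ i

      totalDistance : ℕ
      totalDistance = sum (map (λ i → len (route i)) S)

-- The construction (G, R_A) from a 3-partition instance (0-indexed)

data Vtx (r : ℕ) : Set where
  D : Vtx r
  u : Fin (3 * r) → Vtx r
  v : Fin r → Vtx r

_≟Vtx_ : ∀ {r} → DecidableEquality (Vtx r)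
D ≟Vtx D = yes refl
D ≟Vtx u _ = no λ ()
D ≟Vtx v _ = no λ ()
u _ ≟Vtx D = no λ ()
u i ≟Vtx u j with i F.≟ j
... | yes refl = yes refl
... | no ne = no λ { refl → ne refl }
u _ ≟Vtx v _ = no λ ()
v _ ≟Vtx D = no λ ()
v _ ≟Vtx u _ = no λ ()
v i ≟Vtx v j with i F.≟ j
... | yes refl = yes refl
... | no ne = no λ { refl → ne refl }

-- edges {u_i, v_1}, {v_j, v_{j+1}}, {v_r, D}, all of length 1
data Edge (r : ℕ) : Vtx r → Vtx r → ℕ → Set where
  e-uv : (i : Fin (3 * r)) (k : Fin r) → toℕ k ≡ 0 → Edge r (u i) (v k) 1
  e-vv : (j k : Fin r) → toℕ k ≡ suc (toℕ j) → Edge r (v j) (v k) 1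
  e-vD : (j : Fin r) → suc (toℕ j) ≡ r → Edge r (v j) D 1

RG : ℕ → Graph
RG r = record { V = Vtx r ; _≟V_ = _≟Vtx_ ; E = Edge r }

pathU : ∀ {r} → Fin (3 * r) → List (Vtx r)
pathU {r} i = u i ∷ (map v (allFin r) ++ (D ∷ []))

pathV : ∀ {r} → Fin r → List (Vtx r)
pathV {r} j = map v (filter (λ k → toℕ j ≤? toℕ k) (allFin r)) ++ (D ∷ [])

-- the trips R_A = {1, ..., 3r + rM} (0-indexed as Fin (3r + r*M))
RA : (r M : ℕ) → (Fin (3 * r) → ℕ) → (α β : ℕ) → Fin (3 * r + r * M) → Trip (RG r)
RA r M a α β i with splitAt (3 * r) i
... | inj₁ k = record
  { src = u k ; dst = D ; cap = a k ; detour = 0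
  ; preferred = λ p → p ≡ pathU k ; stopLim = 1 ; α = α ; β = β }
... | inj₂ k = record
  { src = v (quotient M k) ; dst = D ; cap = 0 ; detour = 0
  ; preferred = λ p → p ≡ pathV (quotient M k) ; stopLim = 0 ; α = α ; β = β }

module Submission where

-- All edges have length 1, so the distance to D (r+1 at u_i, r+1-k at v_k,
-- 0 at D) drops by at most 1 per edge and bounds walk lengths from below.
-- The preferred path of u_i has length r+1 and its detour limit is 0, so its
-- route has length exactly r+1.  A route from u_j through another u_i splits
-- there into u_j → u_i (length ≥ 2: u_j's only neighbour is v_1) and
-- u_i → D (length ≥ r+1), which is too long.  So a driver u_j carries no
-- other first-kind trip, and a driver v_k (capacity 0) carries nobody else;
-- the driver serving u_i is therefore u_i.  Summing the bound r+1 over the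
-- 3r first-kind drivers, a duplicate-free sublist of S, gives the total.

open import Defs
open import Data.Nat using (ℕ; suc; _+_; _*_; _∸_; _≤_; _<_; z≤n; s≤s)
open import Data.Nat.Properties
open import Data.Fin using (Fin; _↑ˡ_; _↑ʳ_; toℕ; splitAt)
import Data.Fin as F
open import Data.Fin.Properties using (splitAt⁻¹-↑ˡ; splitAt⁻¹-↑ʳ; splitAt-↑ˡ; splitAt-↑ʳ; ↑ˡ-injective)
open import Data.List using (List; []; _∷_; map; allFin; length; lookup; _++_)
open import Data.List.Properties using (length-map; length-++; length-tabulate; map-∘)
open import Data.Nat.ListAction using (sum)
open import Data.List.Membership.Propositional using (_∈_; _─_)
open import Data.List.Membership.Propositional.Properties using (∈-map⁻)
open import Data.List.Relation.Binary.Subset.Propositional using (_⊆_)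
open import Data.List.Relation.Unary.Any using (here; there)
import Data.List.Relation.Unary.All as All
open import Data.List.Relation.Unary.AllPairs using (_∷_)
open import Data.List.Relation.Unary.Unique.Propositional using (Unique)
import Data.List.Relation.Unary.Unique.Propositional.Properties as Unique
open import Data.Product using (Σ; _×_; _,_; proj₁)
open import Data.Sum using (inj₁; inj₂)
open import Data.Empty using (⊥; ⊥-elim)
open import Function using (_∘_)
open import Relation.Binary.PropositionalEquality
open import Relation.Nullary using (yes; no)
open import Algebra.Properties.CommutativeSemigroup +-commutativeSemigroup using (x∙yz≈y∙xz)

module _ {A : Set} where

  sum-─ : (f : A → ℕ) {x : A} (xs : List A) (x∈xs : x ∈ xs) →
          sum (map f xs) ≡ f x + sum (map f (xs ─ x∈xs))
  sum-─ f (y ∷ xs) (here refl) = refl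
  sum-─ f {x} (y ∷ xs) (there x∈xs) =
    trans (cong (f y +_) (sum-─ f xs x∈xs)) (x∙yz≈y∙xz (f y) (f x) _)

  ∈-─ : {x z : A} (xs : List A) → z ∈ xs → z ≢ x → (x∈xs : x ∈ xs) → z ∈ xs ─ x∈xs
  ∈-─ (y ∷ xs) (here refl) z≢x (here refl) = ⊥-elim (z≢x refl)
  ∈-─ (y ∷ xs) (here z≡y)  z≢x (there _)   = here z≡y
  ∈-─ (y ∷ xs) (there z∈xs) z≢x (here _)   = z∈xs
  ∈-─ (y ∷ xs) (there z∈xs) z≢x (there x∈xs) = there (∈-─ xs z∈xs z≢x x∈xs)

  sum-mono-⊆ : (f : A → ℕ) {ys xs : List A} → Unique ys → ys ⊆ xs →
               sum (map f ys) ≤ sum (map f xs)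
  sum-mono-⊆ f {[]} _ _ = z≤n
  sum-mono-⊆ f {y ∷ ys} {xs} (y∉ys ∷ ys-unique) ys⊆xs = begin
    f y + sum (map f ys)              ≤⟨ +-monoʳ-≤ (f y) (sum-mono-⊆ f ys-unique ys⊆rest) ⟩
    f y + sum (map f (xs ─ y∈xs))     ≡⟨ sym (sum-─ f xs y∈xs) ⟩
    sum (map f xs)                    ∎
    where
    open ≤-Reasoning
    y∈xs : y ∈ xs
    y∈xs = ys⊆xs (here refl)
    ys⊆rest : ys ⊆ xs ─ y∈xs
    ys⊆rest z∈ys = ∈-─ xs (ys⊆xs (there z∈ys)) (λ z≡y → All.lookup y∉ys z∈ys (sym z≡y)) y∈xs

  length*≤sum : (f : A → ℕ) {c : ℕ} → (∀ x → c ≤ f x) → (xs : List A) →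
                length xs * c ≤ sum (map f xs)
  length*≤sum f c≤f []       = z≤n
  length*≤sum f c≤f (x ∷ xs) = +-mono-≤ (c≤f x) (length*≤sum f c≤f xs)

  length≤1⇒≡ : {x y : A} {xs : List A} → length xs ≤ 1 → x ∈ xs → y ∈ xs → x ≡ y
  length≤1⇒≡ {xs = _ ∷ []}    _       (here refl) (here refl) = refl
  length≤1⇒≡ {xs = _ ∷ []}    _       (there ())  _
  length≤1⇒≡ {xs = _ ∷ []}    _       _           (there ())
  length≤1⇒≡ {xs = _ ∷ _ ∷ _} (s≤s ()) _           _

data FinSum (m n : ℕ) : Fin (m + n) → Set where
  left  : (i : Fin m) → FinSum m n (i ↑ˡ n)
  right : (j : Fin n) → FinSum m n (m ↑ʳ j)

finSum : ∀ m n (k : Fin (m + n)) → FinSum m n k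
finSum m n k with splitAt m k in eq
... | inj₁ i = subst (FinSum m n) (splitAt⁻¹-↑ˡ eq) (left i)
... | inj₂ j = subst (FinSum m n) (splitAt⁻¹-↑ʳ eq) (right j)

module Walks (G : Graph) where
  open Graph G

  visitedVertex : ∀ {x y} (a d : ℕ) (w : Walk G x y) → Fin (length (visits G a d w)) → V
  visitedVertex a d w p = proj₁ (lookup (visits G a d w) p)

  Lipschitz : (V → ℕ) → Set
  Lipschitz φ = ∀ {x y ℓ} → Adj G x y ℓ → φ x ≤ ℓ + φ y

  potential-bound : {φ : V → ℕ} → Lipschitz φ → ∀ {x y} (w : Walk G x y) →
                    φ x ≤ len G w + φ y
  potential-bound φ-lip stay = ≤-refl
  potential-bound {φ} φ-lip {x} {y} (step {y = x′} ℓ _ e w) = begin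
    φ x                    ≤⟨ φ-lip e ⟩
    ℓ + φ x′               ≤⟨ +-monoʳ-≤ ℓ (potential-bound φ-lip w) ⟩
    ℓ + (len G w + φ y)    ≡⟨ sym (+-assoc ℓ _ _) ⟩
    ℓ + len G w + φ y      ∎
    where open ≤-Reasoning

  split-at-visit : ∀ {x y z} (a d : ℕ) (w : Walk G x y) (p : Fin (length (visits G a d w))) →
                   visitedVertex a d w p ≡ z →
                   Σ (Walk G x z) λ w₁ → Σ (Walk G z y) λ w₂ → len G w₁ + len G w₂ ≡ len G w
  split-at-visit a d stay                F.zero refl = stay , stay , refl
  split-at-visit a d w@(step _ _ _ _)    F.zero refl = stay , w , refl
  split-at-visit a d (step ℓ wt e w) (F.suc p) at-z
    with w₁ , w₂ , len-eq ← split-at-visit (d + ℓ) (d + ℓ + wt) w p at-z =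
    step ℓ wt e w₁ , w₂ , trans (+-assoc ℓ (len G w₁) _) (cong (ℓ +_) len-eq)

module Network (r : ℕ) where
  open Walks (RG r) public

  G : Graph
  G = RG r

  unit-length : ∀ {x y ℓ} → Adj G x y ℓ → ℓ ≡ 1
  unit-length (inj₁ (e-uv _ _ _)) = refl
  unit-length (inj₁ (e-vv _ _ _)) = refl
  unit-length (inj₁ (e-vD _ _))   = refl
  unit-length (inj₂ (e-uv _ _ _)) = refl
  unit-length (inj₂ (e-vv _ _ _)) = refl
  unit-length (inj₂ (e-vD _ _))   = refl

  verts-length : ∀ {x y} (w : Walk G x y) → length (verts G w) ≡ suc (len G w)
  verts-length stay            = refl
  verts-length (step ℓ _ e w) =
    cong suc (trans (verts-length w) (cong (_+ len G w) (sym (unit-length e))))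

  pathU-length : (j : Fin (3 * r)) → length (pathU {r} j) ≡ suc (r + 1)
  pathU-length j = cong suc (begin
    length (map v (allFin r) ++ D ∷ [])  ≡⟨ length-++ (map v (allFin r)) ⟩
    length (map v (allFin r)) + 1        ≡⟨ cong (_+ 1) (length-map v (allFin r)) ⟩
    length (allFin r) + 1                ≡⟨ cong (_+ 1) (length-tabulate (λ k → k)) ⟩
    r + 1                                ∎)
    where open ≡-Reasoning

  preferred-length : ∀ {j} (P : Walk G (u j) D) → verts G P ≡ pathU j → len G P ≡ r + 1
  preferred-length {j} P P-is-pathU =
    suc-injective (trans (sym (verts-length P)) (trans (cong length P-is-pathU) (pathU-length j)))

  -- Graph distance to D (v k is the paper's v_{k+1}).
  distD : Vtx r → ℕ
  distD D     = 0
  distD (u _) = suc r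
  distD (v k) = r ∸ toℕ k

  distD-lipschitz : Lipschitz distD
  distD-lipschitz (inj₁ (e-uv _ k k≡0)) rewrite k≡0 = ≤-refl
  distD-lipschitz (inj₁ (e-vv j k k≡j+1)) rewrite k≡j+1 = ∸-suc r (toℕ j)
    where
    ∸-suc : ∀ m n → m ∸ n ≤ suc (m ∸ suc n)
    ∸-suc 0       0       = z≤n
    ∸-suc 0       (suc n) = z≤n
    ∸-suc (suc m) 0       = ≤-refl
    ∸-suc (suc m) (suc n) = ∸-suc m n
  distD-lipschitz (inj₁ (e-vD j j+1≡r)) = begin
    r ∸ toℕ j            ≡⟨ cong (_∸ toℕ j) (sym j+1≡r) ⟩
    suc (toℕ j) ∸ toℕ j  ≡⟨ m+n∸n≡m 1 (toℕ j) ⟩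
    1                    ∎
    where open ≤-Reasoning
  distD-lipschitz (inj₂ (e-uv _ k _)) = ≤-trans (m∸n≤m r (toℕ k)) (m≤n+m r 2)
  distD-lipschitz (inj₂ (e-vv j k k≡j+1)) rewrite k≡j+1 =
    ≤-trans (∸-monoʳ-≤ r (n≤1+n (toℕ j))) (n≤1+n _)
  distD-lipschitz (inj₂ (e-vD _ _)) = z≤n

  u-to-D-length : ∀ {j} (w : Walk G (u j) D) → r + 1 ≤ len G w
  u-to-D-length w =
    subst₂ _≤_ (+-comm 1 r) (+-identityʳ _) (potential-bound distD-lipschitz w)

  v-to-u-length : ∀ {k i} (w : Walk G (v k) (u i)) → 1 ≤ len G w
  v-to-u-length (step ℓ _ e _) = subst (λ ℓ → 1 ≤ ℓ + _) (sym (unit-length e)) (s≤s z≤n)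

  -- A walk between distinct first-kind sources goes through v_1: length ≥ 2.
  u-to-u-length : ∀ {i j} → i ≢ j → (w : Walk G (u j) (u i)) → 2 ≤ len G w
  u-to-u-length i≢j stay = ⊥-elim (i≢j refl)
  u-to-u-length i≢j (step _ _ (inj₁ (e-uv _ _ _)) w) = s≤s (v-to-u-length w)

  short-route-avoids : ∀ {i j} → i ≢ j → (w : Walk G (u j) D) → len G w ≤ r + 1 →
                       ∀ a d p → visitedVertex a d w p ≢ u i
  short-route-avoids i≢j w short a d p at-u-i
    with w₁ , w₂ , len-eq ← split-at-visit a d w p at-u-i =
    <⇒≱ (m<n+m (r + 1) {2} (s≤s z≤n)) (begin
      2 + (r + 1)           ≤⟨ +-mono-≤ (u-to-u-length i≢j w₁) (u-to-D-length w₂) ⟩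
      len G w₁ + len G w₂   ≡⟨ len-eq ⟩
      len G w               ≤⟨ short ⟩
      r + 1                 ∎)
    where open ≤-Reasoning

module Reduction (r M : ℕ) (a : Fin (3 * r) → ℕ) (α β : ℕ) where
  open Network r public
  open Trip using (src; dst; cap; detour; preferred)

  -- R_A, indexed so that j ↑ˡ r*M is the trip from u_j and 3r ↑ʳ k a trip from a v-vertex.
  trip : Fin (3 * r + r * M) → Trip G
  trip = RA r M a α β

  uTrip : Fin (3 * r) → Trip G
  uTrip j = record { src = u j ; dst = D ; cap = a j ; detour = 0
                   ; preferred = λ p → p ≡ pathU j ; stopLim = 1 ; α = α ; β = β }

  trip-↑ˡ : ∀ j → trip (j ↑ˡ r * M) ≡ uTrip j
  trip-↑ˡ j rewrite splitAt-↑ˡ (3 * r) j (r * M) = refl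

  trip-↑ʳ-cap : ∀ k → cap (trip (3 * r ↑ʳ k)) ≡ 0
  trip-↑ʳ-cap k rewrite splitAt-↑ʳ (3 * r) (r * M) k = refl

  uTrip-route-length : ∀ {t j} → t ≡ uTrip j → (w : Walk G (src t) (dst t)) → r + 1 ≤ len G w
  uTrip-route-length refl = u-to-D-length

  uTrip-route-avoids : ∀ {t i j} → t ≡ uTrip j → i ≢ j → (w : Walk G (src t) (dst t)) →
                       Σ (Walk G (src t) (dst t)) (λ P → preferred t (verts G P)
                                                       × len G w ≤ len G P + detour t) →
                       ∀ a₀ d₀ p → visitedVertex a₀ d₀ w p ≢ u i
  uTrip-route-avoids refl i≢j w (P , P-is-pathU , w≤P+0) =
    short-route-avoids i≢j w
      (subst (len G w ≤_) (trans (+-identityʳ _) (preferred-length P P-is-pathU)) w≤P+0)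

  module _ (sol : Solution G trip) where
    open Solution sol

    first : Fin (3 * r) → Fin (3 * r + r * M)
    first j = j ↑ˡ r * M

    u-driver-carries-no-u : ∀ {i j} → first j ∈ S → first i ∈ σ (first j) → i ≡ j
    u-driver-carries-no-u {i} {j} driver passenger with i F.≟ j
    ... | yes i≡j = i≡j
    ... | no i≢j  = ⊥-elim (no-pickup (Serves.carry serving (first i) passenger first-i≢first-j))
      where
      serving : Serves G trip (first j) (σ (first j)) (τ (first j)) (route (first j))
      serving = serves (first j) driver
      first-i≢first-j : first i ≢ first j
      first-i≢first-j eq = i≢j (↑ˡ-injective (r * M) i j eq)
      -- The route of u_j never reaches u_i, so u_i cannot be picked up.
      no-pickup : PickDrop G (visits G (τ (first j)) (τ (first j)) (route (first j)))
                           (trip (first i)) → ⊥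
      no-pickup (p , _ , _ , picked-up , _) =
        uTrip-route-avoids (trip-↑ˡ j) i≢j (route (first j)) (Serves.detourOK serving) _ _ p
          (trans picked-up (cong src (trip-↑ˡ i)))

    -- A second-kind driver has capacity 0 and so serves only itself.
    v-driver-alone : ∀ {k x} → (3 * r ↑ʳ k) ∈ S → x ∈ σ (3 * r ↑ʳ k) → x ≡ 3 * r ↑ʳ k
    v-driver-alone {k} driver x∈σ =
      length≤1⇒≡ (subst (λ c → length (σ (3 * r ↑ʳ k)) ≤ suc c) (trip-↑ʳ-cap k)
                   (Serves.capacity serving))
                 x∈σ (Serves.self serving)
      where
      serving : Serves G trip (3 * r ↑ʳ k) (σ (3 * r ↑ʳ k)) (τ (3 * r ↑ʳ k)) (route (3 * r ↑ʳ k))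
      serving = serves (3 * r ↑ʳ k) driver

    server-of-first : ∀ i k → k ∈ S → first i ∈ σ k → first i ∈ S
    server-of-first i k driver passenger with finSum (3 * r) (r * M) k
    ... | left j  rewrite u-driver-carries-no-u driver passenger = driver
    ... | right _ rewrite v-driver-alone driver passenger = driver

    first-drives : ∀ i → first i ∈ S
    first-drives i with k , driver , passenger ← cover (first i) =
      server-of-first i k driver passenger

    routeLength : Fin (3 * r + r * M) → ℕ
    routeLength k = len G (route k)

    total-distance-bound : 3 * r * (r + 1) ≤ totalDistance
    total-distance-bound = begin
      3 * r * (r + 1)                                     ≡⟨ cong (_* (r + 1)) (sym length-firsts) ⟩
      length (allFin (3 * r)) * (r + 1)                   ≤⟨ length*≤sum (routeLength ∘ first) first-route-length
                                                               (allFin (3 * r)) ⟩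
      sum (map (routeLength ∘ first) (allFin (3 * r)))    ≡⟨ cong sum (map-∘ (allFin (3 * r))) ⟩
      sum (map routeLength (map first (allFin (3 * r))))  ≤⟨ sum-mono-⊆ routeLength firsts-unique firsts⊆S ⟩
      totalDistance                                       ∎
      where
      open ≤-Reasoning
      length-firsts : length (allFin (3 * r)) ≡ 3 * r
      length-firsts = length-tabulate (λ j → j)
      first-route-length : ∀ j → r + 1 ≤ routeLength (first j)
      first-route-length j = uTrip-route-length (trip-↑ˡ j) (route (first j))
      firsts-unique : Unique (map first (allFin (3 * r)))
      firsts-unique = Unique.map⁺ (↑ˡ-injective (r * M) _ _) (Unique.allFin⁺ (3 * r))
      firsts⊆S : map first (allFin (3 * r)) ⊆ S
      firsts⊆S x∈ with j , _ , refl ← ∈-map⁻ first x∈ = first-drives j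

-- The theorem.

lemma1 : (r M : ℕ) (a : Fin (3 * r) → ℕ) →
    2 ≤ r →
    (∀ i → 0 < a i) →
    sum (map a (allFin (3 * r))) ≡ r * M →
    (∀ i → M < 4 * a i × 2 * a i < M) →
    (α β : ℕ) → α < β → α + suc r ≤ β →
    (sol : Solution (RG r) (RA r M a α β)) →
    (∀ i → (i ↑ˡ (r * M)) ∈ Solution.S sol)
    × 3 * r * (r + 1) ≤ Solution.totalDistance sol
lemma1 r M a _ _ _ _ α β _ _ sol =
  first-drives sol , total-distance-bound sol
  where open Reduction r M a α β
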